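{- Let $T$ be a finite tree and $c\in\mathcal{C}^2_{\mathcal{MAJ}}(T)$. A node $u$ of $T$ is a fixed node of $c$ if and only if $|N_t^{1-c(u)}(u)-N_t^{c(u)}(u)|\le N_f^{c(u)}(u)-N_f^{1-c(u)}(u)$, and a toggle node of $c$ if and only if $|N_f^{c(u)}(u)-N_f^{1-c(u)}(u)|<N_t^{1-c(u)}(u)-N_t^{c(u)}(u)$.
   Context: Colorings are maps $c:V\to\{0,1\}$; $N^i(v)$ is the set of neighbors of $v$ with color $i$. $\mathcal{MAJ}(c)(v)=c(v)$ if $|N^{c(v)}(v)|\ge|N^{1-c(v)}(v)|$, else $1-c(v)$ (simultaneous update). $\mathcal{C}^2_{\mathcal{MAJ}}(T)$ is the set of colorings $c$ with $\mathcal{MAJ}(c)\ne c$ and $\mathcal{MAJ}(\mathcal{MAJ}(c))=c$. A node $u$ is a fixed node of $c$ if $\mathcal{MAJ}(c)(u)=c(u)$ and a toggle node otherwise. $N^i_f(u)$ (resp. $N^i_t(u)$) is the number of neighbors of $u$ with color $i$ under $c$ that are fixed (resp. toggle) nodes. -}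

module Defs where

open import Data.Nat using (ℕ; zero; suc; _≤ᵇ_; _≥_; _<_; _≤_)
open import Data.Bool using (Bool; true; false; not; if_then_else_; _∧_)
open import Data.Fin using (Fin)
open import Data.Fin.Properties using (_≟_)
open import Data.List using (List; []; _∷_; length; filter; allFin)
open import Data.List.Relation.Unary.Unique.Propositional using (Unique)
open import Data.Product using (_×_; ∃)
open import Relation.Nullary using (¬_)
open import Relation.Nullary.Decidable using (⌊_⌋)
open import Relation.Binary.PropositionalEquality using (_≡_)
open import Data.Bool using (T)

record Graph (n : ℕ) : Set where
  field
    adj   : Fin n → Fin n → Bool
    sym   : ∀ u v → adj u v ≡ adj v u
    irrefl : ∀ u → adj u u ≡ false

open Graph public

-- Colorings c : V → {0,1}, encoded as Bool (false = 0, true = 1).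
Coloring : ℕ → Set
Coloring n = Fin n → Bool

countL : ∀ {A : Set} → (A → Bool) → List A → ℕ
countL p [] = 0
countL p (x ∷ xs) = if p x then suc (countL p xs) else countL p xs

count : ∀ {n} → (Fin n → Bool) → ℕ
count p = countL p (allFin _)

eqB : Bool → Bool → Bool
eqB true true = true
eqB false false = true
eqB _ _ = false

Ncol : ∀ {n} → Graph n → Coloring n → Bool → Fin n → ℕ
Ncol G c i v = count (λ w → adj G v w ∧ eqB (c w) i)

-- Synchronous majority rule (ties keep the current colour).
MAJ : ∀ {n} → Graph n → Coloring n → Coloring n
MAJ G c v = if Ncol G c (not (c v)) v ≤ᵇ Ncol G c (c v) v then c v else not (c v)

InC2 : ∀ {n} → Graph n → Coloring n → Set
InC2 G c = ¬ (∀ v → MAJ G c v ≡ c v) × (∀ v → MAJ G (MAJ G c) v ≡ c v)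

isFixed : ∀ {n} → Graph n → Coloring n → Fin n → Bool
isFixed G c u = eqB (MAJ G c u) (c u)

Fixed : ∀ {n} → Graph n → Coloring n → Fin n → Set
Fixed G c u = MAJ G c u ≡ c u

Toggle : ∀ {n} → Graph n → Coloring n → Fin n → Set
Toggle G c u = ¬ (MAJ G c u ≡ c u)

Nf : ∀ {n} → Graph n → Coloring n → Bool → Fin n → ℕ
Nf G c i u = count (λ w → adj G u w ∧ eqB (c w) i ∧ isFixed G c w)

Nt : ∀ {n} → Graph n → Coloring n → Bool → Fin n → ℕ
Nt G c i u = count (λ w → adj G u w ∧ eqB (c w) i ∧ not (isFixed G c w))

data Reach {n} (G : Graph n) (u : Fin n) : Fin n → Set where
  here : Reach G u u
  step : ∀ {v w} → Reach G u v → T (adj G v w) → Reach G u w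

data Walk {n} (G : Graph n) : List (Fin n) → Set where
  single : ∀ v → Walk G (v ∷ [])
  cons   : ∀ {v w vs} → T (adj G v w) → Walk G (w ∷ vs) → Walk G (v ∷ w ∷ vs)

data IsCycle {n} (G : Graph n) : List (Fin n) → Set where
  cyc : ∀ {v0 vs vk} → Unique (v0 ∷ vs Data.List.++ (vk ∷ [])) →
        length vs ≥ 1 →
        Walk G (v0 ∷ vs Data.List.++ (vk ∷ [])) → T (adj G vk v0) →
        IsCycle G (v0 ∷ vs Data.List.++ (vk ∷ []))

IsTree : ∀ {n} → Graph n → Set
IsTree {n} G = (1 ≤ n) × (∀ u v → Reach G u v) × (∀ vs → ¬ IsCycle G vs)

-- Whether u keeps its colour is decided by comparing neighbours of its own colour
-- with neighbours of the other colour. Write a, b for the fixed and x, y for the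
-- toggle neighbours of colour c(u) and 1 - c(u). Under c the comparison is
-- b + y ≤ a + x; under MAJ(c) fixed neighbours keep their colour and toggle
-- neighbours swap it, so it becomes b + x ≤ a + y. Since MAJ(MAJ(c)) = c, u is fixed
-- (toggle) for MAJ(c) exactly when it is for c, hence u is fixed iff both
-- inequalities hold, i.e. |y - x| ≤ a - b, and toggle iff a + x < b + y and
-- b + x < a + y, i.e. |a - b| < y - x.

{-# OPTIONS --safe #-}
module Submission where

open import Defs
open import Data.Nat using (ℕ)
open import Data.Bool using (not)
open import Data.Fin using (Fin)
open import Data.Integer using (+_; _-_; ∣_∣; _≤_; _<_)
open import Data.Product using (_×_)
open import Function.Bundles using (_⇔_)

open import Data.Bool using (Bool; true; false; _∧_; T)
open import Data.Bool.Properties using (∧-assoc; ∧-zeroʳ; not-involutive; not-¬; ¬-not)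
open import Data.List using (List; []; _∷_; allFin)
open import Data.Product using (_,_; proj₁)
open import Data.Sum using ([_,_]′)
open import Data.Unit using (tt)
open import Function using (_∘_)
open import Function.Bundles using (mk⇔; Equivalence)
open import Function.Construct.Composition using (_⇔-∘_)
open import Function.Construct.Symmetry using (⇔-sym)
open import Data.Product.Function.NonDependent.Propositional using (_×-⇔_)
open import Relation.Nullary using (contradiction)
open import Relation.Binary.PropositionalEquality using (_≡_; refl; trans; cong; cong₂; subst; subst₂) renaming (sym to ≡-sym)
import Data.Nat as ℕ
import Data.Nat.Properties as ℕ
open import Data.Integer using (ℤ; _+_; -_; +≤+; +<+; -≤+; -[1+_])
open import Data.Integer.Properties using (drop‿+≤+; drop‿+<+; +-monoˡ-≤; +-monoˡ-<; ≤-trans; ≤-<-trans; ≤-refl; +∣i∣≡i⊎+∣i∣≡-i; ∣-i∣≡∣i∣)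
open import Data.Integer.Tactic.RingSolver using (solve-∀)

open Equivalence using (to; from)

countL-cong : ∀ {A : Set} {p q : A → Bool} (xs : List A) →
              (∀ x → p x ≡ q x) → countL p xs ≡ countL q xs
countL-cong [] p≗q = refl
countL-cong {q = q} (x ∷ xs) p≗q rewrite p≗q x with q x
... | true  = cong ℕ.suc (countL-cong xs p≗q)
... | false = countL-cong xs p≗q

countL-split : ∀ {A : Set} (p q : A → Bool) (xs : List A) →
  countL p xs ≡ countL (λ x → p x ∧ q x) xs ℕ.+ countL (λ x → p x ∧ not (q x)) xs
countL-split p q [] = refl
countL-split p q (x ∷ xs) with p x | q x
... | true  | true  = cong ℕ.suc (countL-split p q xs)
... | true  | false = trans (cong ℕ.suc (countL-split p q xs)) (≡-sym (ℕ.+-suc _ _))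
... | false | _     = countL-split p q xs

eqB-transferˡ : ∀ m x i → eqB m i ∧ eqB m x ≡ eqB x i ∧ eqB m x
eqB-transferˡ true  true  i = refl
eqB-transferˡ false false i = refl
eqB-transferˡ true  false i = trans (∧-zeroʳ _) (≡-sym (∧-zeroʳ _))
eqB-transferˡ false true  i = trans (∧-zeroʳ _) (≡-sym (∧-zeroʳ _))

eqB-not-transferˡ : ∀ m x i → eqB m i ∧ not (eqB m x) ≡ eqB x (not i) ∧ not (eqB m x)
eqB-not-transferˡ true  true  i     = trans (∧-zeroʳ _) (≡-sym (∧-zeroʳ _))
eqB-not-transferˡ false false i     = trans (∧-zeroʳ _) (≡-sym (∧-zeroʳ _))
eqB-not-transferˡ true  false true  = refl
eqB-not-transferˡ true  false false = refl
eqB-not-transferˡ false true  true  = refl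
eqB-not-transferˡ false true  false = refl

i≤+∣i∣ : ∀ i → i ≤ + ∣ i ∣
i≤+∣i∣ (+ n)    = ≤-refl
i≤+∣i∣ -[1+ n ] = -≤+

-i≤+∣i∣ : ∀ i → - i ≤ + ∣ i ∣
-i≤+∣i∣ i = subst (- i ≤_) (cong +_ (∣-i∣≡∣i∣ i)) (i≤+∣i∣ (- i))

+∣i∣-elim : ∀ (P : ℤ → Set) i → P i → P (- i) → P (+ ∣ i ∣)
+∣i∣-elim P i Pi P-i = [ (λ e → subst P (≡-sym e) Pi) , (λ e → subst P (≡-sym e) P-i) ]′ (+∣i∣≡i⊎+∣i∣≡-i i)

+∣i∣≤j⇔ : ∀ i j → + ∣ i ∣ ≤ j ⇔ (i ≤ j × - i ≤ j)
+∣i∣≤j⇔ i j = mk⇔ (λ h → ≤-trans (i≤+∣i∣ i) h , ≤-trans (-i≤+∣i∣ i) h)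
                  (λ (i≤j , -i≤j) → +∣i∣-elim (_≤ j) i i≤j -i≤j)

+∣i∣<j⇔ : ∀ i j → + ∣ i ∣ < j ⇔ (i < j × - i < j)
+∣i∣<j⇔ i j = mk⇔ (λ h → ≤-<-trans (i≤+∣i∣ i) h , ≤-<-trans (-i≤+∣i∣ i) h)
                  (λ (i<j , -i<j) → +∣i∣-elim (_< j) i i<j -i<j)

-≤-⇔ : ∀ i j k l → i - j ≤ k - l ⇔ l + i ≤ k + j
-≤-⇔ i j k l = mk⇔ (subst₂ _≤_ (shift i j l) (shift′ k j l) ∘ +-monoˡ-≤ (j + l))
                   (subst₂ _≤_ (unshift i j l) (unshift′ k j l) ∘ +-monoˡ-≤ (- (j + l)))
  where
  shift : ∀ i j l → (i - j) + (j + l) ≡ l + i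
  shift = solve-∀
  shift′ : ∀ k j l → (k - l) + (j + l) ≡ k + j
  shift′ = solve-∀
  unshift : ∀ i j l → (l + i) + - (j + l) ≡ i - j
  unshift = solve-∀
  unshift′ : ∀ k j l → (k + j) + - (j + l) ≡ k - l
  unshift′ = solve-∀

-<-⇔ : ∀ i j k l → i - j < k - l ⇔ i + l < j + k
-<-⇔ i j k l = mk⇔ (subst₂ _<_ (shift i j l) (shift′ k j l) ∘ +-monoˡ-< (j + l))
                   (subst₂ _<_ (unshift i j l) (unshift′ k j l) ∘ +-monoˡ-< (- (j + l)))
  where
  shift : ∀ i j l → (i - j) + (j + l) ≡ i + l
  shift = solve-∀
  shift′ : ∀ k j l → (k - l) + (j + l) ≡ j + k
  shift′ = solve-∀
  unshift : ∀ i j l → (i + l) + - (j + l) ≡ i - j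
  unshift = solve-∀
  unshift′ : ∀ k j l → (j + k) + - (j + l) ≡ k - l
  unshift′ = solve-∀

-[i-j]≡j-i : ∀ i j → - (i - j) ≡ j - i
-[i-j]≡j-i = solve-∀

+∣i-j∣≤k-l⇔ : ∀ i j k l → + ∣ i - j ∣ ≤ k - l ⇔ (l + i ≤ k + j × l + j ≤ k + i)
+∣i-j∣≤k-l⇔ i j k l =
  (-≤-⇔ i j k l ×-⇔ subst (λ d → d ≤ k - l ⇔ l + j ≤ k + i) (≡-sym (-[i-j]≡j-i i j)) (-≤-⇔ j i k l))
  ⇔-∘ +∣i∣≤j⇔ (i - j) (k - l)

+∣i-j∣<k-l⇔ : ∀ i j k l → + ∣ i - j ∣ < k - l ⇔ (i + l < j + k × j + l < i + k)
+∣i-j∣<k-l⇔ i j k l =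
  (-<-⇔ i j k l ×-⇔ subst (λ d → d < k - l ⇔ j + l < i + k) (≡-sym (-[i-j]≡j-i i j)) (-<-⇔ j i k l))
  ⇔-∘ +∣i∣<j⇔ (i - j) (k - l)

+≤+⇔ : ∀ {m n} → m ℕ.≤ n ⇔ + m ≤ + n
+≤+⇔ = mk⇔ +≤+ drop‿+≤+

+<+⇔ : ∀ {m n} → m ℕ.< n ⇔ + m < + n
+<+⇔ = mk⇔ +<+ drop‿+<+

module _ {n : ℕ} (G : Graph n) (c : Coloring n) where

  Ncol≡Nf+Nt : ∀ i u → Ncol G c i u ≡ Nf G c i u ℕ.+ Nt G c i u
  Ncol≡Nf+Nt i u = trans (countL-split _ (isFixed G c) (allFin n))
    (cong₂ ℕ._+_ (countL-cong (allFin n) (λ w → ∧-assoc (adj G u w) _ _))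
                 (countL-cong (allFin n) (λ w → ∧-assoc (adj G u w) _ _)))

  -- A fixed neighbour keeps its colour under MAJ, a toggle neighbour swaps it.
  Ncol-MAJ≡Nf+Nt-not : ∀ i u → Ncol G (MAJ G c) i u ≡ Nf G c i u ℕ.+ Nt G c (not i) u
  Ncol-MAJ≡Nf+Nt-not i u = trans (countL-split _ (isFixed G c) (allFin n))
    (cong₂ ℕ._+_ (countL-cong (allFin n) (λ w → transfer (adj G u w) (eqB-transferˡ (MAJ G c w) (c w) i)))
                 (countL-cong (allFin n) (λ w → transfer (adj G u w) (eqB-not-transferˡ (MAJ G c w) (c w) i))))
    where
    transfer : ∀ a {b d e} → b ∧ d ≡ e → (a ∧ b) ∧ d ≡ a ∧ e
    transfer a {b} {d} b∧d≡e = trans (∧-assoc a b d) (cong (a ∧_) b∧d≡e)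

  fixed⇔majority : ∀ v → Fixed G c v ⇔ Ncol G c (not (c v)) v ℕ.≤ Ncol G c (c v) v
  fixed⇔majority v = mk⇔ to′ from′
    where
    to′ : Fixed G c v → Ncol G c (not (c v)) v ℕ.≤ Ncol G c (c v) v
    to′ fixed with Ncol G c (not (c v)) v ℕ.≤ᵇ Ncol G c (c v) v in eq
    ... | true  = ℕ.≤ᵇ⇒≤ _ _ (subst T (≡-sym eq) tt)
    ... | false = contradiction (≡-sym fixed) (not-¬ refl)
    from′ : Ncol G c (not (c v)) v ℕ.≤ Ncol G c (c v) v → Fixed G c v
    from′ le with Ncol G c (not (c v)) v ℕ.≤ᵇ Ncol G c (c v) v in eq
    ... | true  = refl
    ... | false = contradiction (ℕ.≤⇒≤ᵇ le) (subst T eq)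

  toggle⇔minority : ∀ v → Toggle G c v ⇔ Ncol G c (c v) v ℕ.< Ncol G c (not (c v)) v
  toggle⇔minority v = mk⇔ (ℕ.≰⇒> ∘ (_∘ from (fixed⇔majority v)))
                           (λ lt → ℕ.<⇒≱ lt ∘ to (fixed⇔majority v))

  fixed⇔Nf+Nt-majority : ∀ v → Fixed G c v ⇔
    Nf G c (not (c v)) v ℕ.+ Nt G c (not (c v)) v ℕ.≤ Nf G c (c v) v ℕ.+ Nt G c (c v) v
  fixed⇔Nf+Nt-majority v =
    subst₂ (λ p q → Fixed G c v ⇔ p ℕ.≤ q) (Ncol≡Nf+Nt _ v) (Ncol≡Nf+Nt _ v) (fixed⇔majority v)

  toggle⇔Nf+Nt-minority : ∀ v → Toggle G c v ⇔
    Nf G c (c v) v ℕ.+ Nt G c (c v) v ℕ.< Nf G c (not (c v)) v ℕ.+ Nt G c (not (c v)) v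
  toggle⇔Nf+Nt-minority v =
    subst₂ (λ p q → Toggle G c v ⇔ p ℕ.< q) (Ncol≡Nf+Nt _ v) (Ncol≡Nf+Nt _ v) (toggle⇔minority v)

  Ncol-MAJ-not≡Nf+Nt : ∀ i u → Ncol G (MAJ G c) (not i) u ≡ Nf G c (not i) u ℕ.+ Nt G c i u
  Ncol-MAJ-not≡Nf+Nt i u = trans (Ncol-MAJ≡Nf+Nt-not (not i) u)
                                  (cong (λ j → Nf G c (not i) u ℕ.+ Nt G c j u) (not-involutive i))

module _ {n : ℕ} (G : Graph n) (c : Coloring n) {u : Fin n}
         (period₂ : MAJ G (MAJ G c) u ≡ c u) where

  private
    a b x y : ℕ
    a = Nf G c (c u) u
    b = Nf G c (not (c u)) u
    x = Nt G c (c u) u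
    y = Nt G c (not (c u)) u

  fixed⇒MAJ-fixed : Fixed G c u → Fixed G (MAJ G c) u
  fixed⇒MAJ-fixed fixed = trans period₂ (≡-sym fixed)

  toggle⇒MAJ-toggle : Toggle G c u → Toggle G (MAJ G c) u
  toggle⇒MAJ-toggle toggle fixed′ = toggle (trans (≡-sym fixed′) period₂)

  fixed⇔counts : Fixed G c u ⇔ (b ℕ.+ y ℕ.≤ a ℕ.+ x × b ℕ.+ x ℕ.≤ a ℕ.+ y)
  fixed⇔counts = mk⇔ (λ fixed → to (fixed⇔Nf+Nt-majority G c u) fixed , majority-next fixed)
                     (from (fixed⇔Nf+Nt-majority G c u) ∘ proj₁)
    where
    majority-next : Fixed G c u → b ℕ.+ x ℕ.≤ a ℕ.+ y
    majority-next fixed = subst₂ ℕ._≤_ (Ncol-MAJ-not≡Nf+Nt G c (c u) u) (Ncol-MAJ≡Nf+Nt-not G c (c u) u)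
      (subst (λ i → Ncol G (MAJ G c) (not i) u ℕ.≤ Ncol G (MAJ G c) i u) fixed
        (to (fixed⇔majority G (MAJ G c) u) (fixed⇒MAJ-fixed fixed)))

  toggle⇔counts : Toggle G c u ⇔ (a ℕ.+ x ℕ.< b ℕ.+ y × b ℕ.+ x ℕ.< a ℕ.+ y)
  toggle⇔counts = mk⇔ (λ toggle → to (toggle⇔Nf+Nt-minority G c u) toggle , minority-next toggle)
                      (from (toggle⇔Nf+Nt-minority G c u) ∘ proj₁)
    where
    minority-next : Toggle G c u → b ℕ.+ x ℕ.< a ℕ.+ y
    minority-next toggle = subst₂ ℕ._<_ (Ncol-MAJ-not≡Nf+Nt G c (c u) u) (Ncol-MAJ≡Nf+Nt-not G c (c u) u)
      (subst (λ i → Ncol G (MAJ G c) (not (c u)) u ℕ.< Ncol G (MAJ G c) i u) (not-involutive (c u))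
        (subst (λ i → Ncol G (MAJ G c) i u ℕ.< Ncol G (MAJ G c) (not i) u) (¬-not toggle)
          (to (toggle⇔minority G (MAJ G c) u) (toggle⇒MAJ-toggle toggle))))

lemma11 : ∀ {n : ℕ} (G : Graph n) → IsTree G → (c : Coloring n) → InC2 G c → (u : Fin n) →
    (Fixed G c u ⇔ (+ ∣ + Nt G c (not (c u)) u - + Nt G c (c u) u ∣ ≤ + Nf G c (c u) u - + Nf G c (not (c u)) u))
    × (Toggle G c u ⇔ (+ ∣ + Nf G c (c u) u - + Nf G c (not (c u)) u ∣ < + Nt G c (not (c u)) u - + Nt G c (c u) u))
lemma11 G _ c (_ , period₂) u =
    ⇔-sym (+∣i-j∣≤k-l⇔ (+ y) (+ x) (+ a) (+ b)) ⇔-∘ ((+≤+⇔ ×-⇔ +≤+⇔) ⇔-∘ fixed⇔counts G c (period₂ u))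
  , ⇔-sym (+∣i-j∣<k-l⇔ (+ a) (+ b) (+ y) (+ x)) ⇔-∘ ((+<+⇔ ×-⇔ +<+⇔) ⇔-∘ toggle⇔counts G c (period₂ u))
  where
  a b x y : ℕ
  a = Nf G c (c u) u
  b = Nf G c (not (c u)) u
  x = Nt G c (c u) u
  y = Nt G c (not (c u)) u
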